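{- Let $Q$ be a set of questions for $(a,b,c)$-Mastermind in which every question is of type $A$, $B$ or $C$, and suppose $Q$ avoids all of the following patterns: (1) two colors missing on the same peg; (2) a missing color on each of the three pegs; (3) a sequence of type $TTT$ (for some $T\in\{A,B,C\}$) together with missing colors on both double pegs of $T$; (4) a sequence of type $TTT$ together with a pair of double-neighboring questions of type $T$; (5) a sequence of type $T_1T_1T_2T_2$ with $T_1\neq T_2$, together with a missing color on the peg that is a double peg of both $T_1$ and $T_2$; (6) a sequence of type $T_1T_1T_2T_3T_3$ with $T_1,T_2,T_3$ pairwise distinct; (7) two different sequences of the same type $T_1T_2$ with $T_1\ne T_2$; (8) a sequence of type $T_1T_2$ with $T_1\neq T_2$, a pair of double-neighboring questions of type $T_2$, and a missing color on the single peg of $T_2$; (9) a pair of double-neighboring questions of type $T$, with missing colors on both double pegs of $T$; (10) two different pairs of double-neighboring questions of the same type $T$; (11) a pair of double-neighboring questions of type $T_1$ and a different pair of double-neighboring questions of type $T_2$ (with $T_1\ne T_2$), together with missing colors on the single pegs of both $T_1$ and $T_2$; (12) a pair of double-neighboring questions of type $A$, one of type $B$, and one of type $C$. Then $Q$ is a feasible strategy for $(a,b,c)$-Mastermind.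
   Context: $[n]=\{1,\dots,n\}$. In $(a,b,c)$-Mastermind, secrets and questions are triples in $[a]\times[b]\times[c]$; coordinates $1,2,3$ are called pegs and entries colors. $g(s,q)$ is the number of $k\in[3]$ with $s_k=q_k$. A strategy $Q$ (set of questions) is feasible if for all distinct secrets $s,s'$ some $q\in Q$ has $g(s,q)\ne g(s',q)$. Relative to $Q$: for $q\in Q$ and peg $k$, let $m_k(q)$ be the number of questions in $Q$ whose $k$-th entry equals $q_k$. A question $q$ is of type $A$ if $(m_1,m_2,m_3)(q)=(1,2,2)$, of type $B$ if $(2,1,2)$, of type $C$ if $(2,2,1)$. The single peg of type $A$, $B$, $C$ is peg $1$, $2$, $3$ respectively; the other two pegs are its double pegs. A color is missing on peg $k$ if it is a color of that peg (in $[a]$, $[b]$, $[c]$ respectively) that is the $k$-th entry of no question of $Q$. Two questions are neighboring if they agree in exactly one coordinate, and double-neighboring if they agree in exactly two coordinates. A set of $k$ questions of $Q$ is a sequence of type $T_1T_2\cdots T_k$ ($T_i\in\{A,B,C\}$) if they can be ordered $q_1,\dots,q_k$ with $q_i,q_{i+1}$ neighboring for all $i\in[k-1]$ and $q_i$ of type $T_i$ for all $i$. A pair of double-neighboring questions of type $T$ means two distinct questions of type $T$ that are double-neighboring. -}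

module Defs where

open import Data.Nat using (ℕ; _+_)
open import Data.Fin using (Fin)
import Data.Fin as Fin
open import Data.Bool using (Bool; true; false)
open import Data.Product using (Σ; ∃; ∃-syntax; _×_; _,_)
open import Data.Sum using (_⊎_)
open import Data.List using (List; []; _∷_; length; filter)
open import Data.List.Membership.Propositional using (_∈_)
open import Data.List.Relation.Unary.All using (All)
open import Data.List.Relation.Unary.Unique.Propositional using (Unique)
open import Data.List.Relation.Unary.Linked using (Linked)
open import Data.List.Relation.Binary.Pointwise using (Pointwise)
open import Relation.Nullary using (¬_; Dec; does)
open import Relation.Binary.PropositionalEquality using (_≡_; _≢_)

data Peg : Set where
  p1 p2 p3 : Peg

data QType : Set where
  A B C : QType

-- The single peg of each type (the other two are its double pegs)
single : QType → Peg
single A = p1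
single B = p2
single C = p3

-- multiplicity vector (m1,m2,m3) defining each type
typeVec : QType → ℕ × ℕ × ℕ
typeVec A = (1 , 2 , 2)
typeVec B = (2 , 1 , 2)
typeVec C = (2 , 2 , 1)

module _ {a b c : ℕ} where

  -- secrets and questions: triples in [a] × [b] × [c] (colors indexed from 0)
  Question : Set
  Question = Fin a × Fin b × Fin c

  Color : Peg → Set
  Color p1 = Fin a
  Color p2 = Fin b
  Color p3 = Fin c

  entry : (k : Peg) → Question → Color k
  entry p1 (x , y , z) = x
  entry p2 (x , y , z) = y
  entry p3 (x , y , z) = z

  _≟c_ : {k : Peg} → (x y : Color k) → Dec (x ≡ y)
  _≟c_ {p1} = Fin._≟_
  _≟c_ {p2} = Fin._≟_
  _≟c_ {p3} = Fin._≟_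

  agree : Peg → Question → Question → ℕ
  agree k s q with does (entry k s ≟c entry k q)
  ... | true = 1
  ... | false = 0

  g : Question → Question → ℕ
  g s q = agree p1 s q + agree p2 s q + agree p3 s q

  Feasible : List Question → Set
  Feasible Q = (s s' : Question) → s ≢ s' → ∃[ q ] (q ∈ Q × g s q ≢ g s' q)

  module _ (Q : List Question) where

    mult : Peg → Question → ℕ
    mult k q = length (filter (λ q' → entry k q' ≟c entry k q) Q)

    HasType : QType → Question → Set
    HasType T q = (mult p1 q , mult p2 q , mult p3 q) ≡ typeVec T

    Missing : (k : Peg) → Color k → Set
    Missing k x = ∀ q → q ∈ Q → entry k q ≢ x

    MissingOn : Peg → Set
    MissingOn k = Σ (Color k) (Missing k)

    Neighboring : Question → Question → Set
    Neighboring q q' = g q q' ≡ 1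

    DoubleNeighboring : Question → Question → Set
    DoubleNeighboring q q' = g q q' ≡ 2

    IsSeq : List QType → List Question → Set
    IsSeq ts qs = Pointwise HasType ts qs × All (_∈ Q) qs × Unique qs
                  × Linked Neighboring qs

    Seq : List QType → Set
    Seq ts = ∃[ qs ] IsSeq ts qs

    DNP : QType → Question → Question → Set
    DNP T q q' = q ∈ Q × q' ∈ Q × q ≢ q' × HasType T q × HasType T q'
                 × DoubleNeighboring q q'

    DNPair : QType → Set
    DNPair T = ∃[ q ] ∃[ q' ] DNP T q q'

    MissingBothDouble : QType → Set
    MissingBothDouble T = (k : Peg) → k ≢ single T → MissingOn k

    AllTyped : Set
    AllTyped = ∀ q → q ∈ Q → HasType A q ⊎ HasType B q ⊎ HasType C q

    Pat1 Pat2 Pat3 Pat4 Pat5 Pat6 Pat7 Pat8 Pat9 Pat10 Pat11 Pat12 : Set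
    Pat1 = ∃[ k ] ∃[ x ] ∃[ y ] (x ≢ y × Missing k x × Missing k y)
    Pat2 = MissingOn p1 × MissingOn p2 × MissingOn p3
    Pat3 = ∃[ T ] (Seq (T ∷ T ∷ T ∷ []) × MissingBothDouble T)
    Pat4 = ∃[ T ] (Seq (T ∷ T ∷ T ∷ []) × DNPair T)
    Pat5 = ∃[ T₁ ] ∃[ T₂ ] (T₁ ≢ T₂ × Seq (T₁ ∷ T₁ ∷ T₂ ∷ T₂ ∷ [])
             × ∃[ k ] (k ≢ single T₁ × k ≢ single T₂ × MissingOn k))
    Pat6 = ∃[ T₁ ] ∃[ T₂ ] ∃[ T₃ ] (T₁ ≢ T₂ × T₁ ≢ T₃ × T₂ ≢ T₃
             × Seq (T₁ ∷ T₁ ∷ T₂ ∷ T₃ ∷ T₃ ∷ []))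
    Pat7 = ∃[ T₁ ] ∃[ T₂ ] (T₁ ≢ T₂ × ∃[ qs ] ∃[ qs' ]
             (IsSeq (T₁ ∷ T₂ ∷ []) qs × IsSeq (T₁ ∷ T₂ ∷ []) qs' × qs ≢ qs'))
    Pat8 = ∃[ T₁ ] ∃[ T₂ ] (T₁ ≢ T₂ × Seq (T₁ ∷ T₂ ∷ []) × DNPair T₂
             × MissingOn (single T₂))
    Pat9 = ∃[ T ] (DNPair T × MissingBothDouble T)
    Pat10 = ∃[ T ] ∃[ q₁ ] ∃[ q₂ ] ∃[ q₃ ] ∃[ q₄ ] (DNP T q₁ q₂ × DNP T q₃ q₄
             × ¬ ((q₁ ≡ q₃ × q₂ ≡ q₄) ⊎ (q₁ ≡ q₄ × q₂ ≡ q₃)))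
    Pat11 = ∃[ T₁ ] ∃[ T₂ ] (T₁ ≢ T₂ × DNPair T₁ × DNPair T₂
             × MissingOn (single T₁) × MissingOn (single T₂))
    Pat12 = DNPair A × DNPair B × DNPair C

{-# OPTIONS --safe #-}

-- Suppose distinct secrets s, s' get equal answers from every question of Q. Call a peg together with
-- the color of s or of s' on it a vertex; its hitters are the questions with that color there, so the
-- multiplicity of a question on a peg is the number of hitters of its vertex, and typing makes this 1 on
-- one peg and 2 on the other two.
-- If s, s' differ on one peg, no question hits either of its two vertices: pattern (1).
-- If they differ on pegs k, l only, equal answers force the hitters of (k, s) and of (l, s') to coincide,
-- and likewise for (k, s') and (l, s); each of these two edges carries 0, 1 or 2 questions, 1 being
-- excluded by typing, and the remaining cases are patterns (1), (9) and (10).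
-- If they differ everywhere, the six vertices form a hexagon (k₀,s) (k₁,s') (k₂,s) (k₀,s') (k₁,s) (k₂,s')
-- and every question hits either nothing or exactly two adjacent vertices. An edge carrying two questions
-- (a double-neighboring pair) has empty neighbours, an edge carrying one is not flanked by two empty ones,
-- and two consecutive empty edges leave a color missing. Runs of singly-loaded edges are sequences of
-- neighboring questions whose types are read off the loads of the adjacent edges; going through the
-- cyclic load patterns up to rotation always produces one of the twelve patterns.

module Submission where

open import Defs
open import Data.Nat using (ℕ; zero; suc; _+_; _≤_; z≤n; s≤s)
open import Data.Nat.Properties
  using (_≟_; ≤-antisym; ≤-trans; ≤-refl; m≤n⇒m≤1+n; 1+n≢0; 1+n≢n; m+1+n≢0; +-cancelʳ-≡)
import Data.Fin as Fin
open import Data.Product using (∃; ∃-syntax; _×_; _,_; proj₁; proj₂)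
open import Data.Sum using (_⊎_; inj₁; inj₂)
open import Data.Empty using (⊥; ⊥-elim)
open import Function using (_∘_)
open import Data.List using (List; []; _∷_; length; filter; removeAt)
open import Data.List.Properties using (length-removeAt′; ∷-injectiveˡ)
open import Data.List.Relation.Unary.All using (All; []; _∷_)
import Data.List.Relation.Unary.All as All
open import Data.List.Relation.Unary.AllPairs using ([]; _∷_)
open import Data.List.Relation.Unary.Any using (here; there; index; any?)
open import Data.List.Relation.Unary.Linked using (Linked; []; [-]; _∷_)
open import Data.List.Relation.Binary.Pointwise using (Pointwise; []; _∷_)
open import Data.List.Relation.Unary.Unique.Propositional using (Unique)
open import Data.List.Relation.Unary.Unique.Propositional.Properties using (filter⁺)
open import Data.List.Membership.Propositional using (_∈_; find; lose)
open import Data.List.Membership.Propositional.Properties using (∈-filter⁺; ∈-filter⁻)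
open import Data.Nat.Solver using (module +-*-Solver)
open import Relation.Nullary using (¬_; Dec; yes; no; ¬?)
open import Relation.Nullary.Decidable using (_×-dec_; decidable-stable)
open import Relation.Unary using (Decidable)
open import Relation.Binary.PropositionalEquality
  using (_≡_; _≢_; refl; sym; trans; cong; cong₂; subst; ≢-sym)

-- Counting in lists without duplicates

module _ {A : Set} where

  ∈-removeAt : ∀ {x y : A} {ys} (x∈ys : x ∈ ys) → y ∈ ys → y ≢ x → y ∈ removeAt ys (index x∈ys)
  ∈-removeAt (here refl) (here refl) y≢x = ⊥-elim (y≢x refl)
  ∈-removeAt (here refl) (there y∈ys) _ = y∈ys
  ∈-removeAt (there x∈ys) (here refl) _ = here refl
  ∈-removeAt (there x∈ys) (there y∈ys) y≢x = there (∈-removeAt x∈ys y∈ys y≢x)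

  unique⊆⇒length≤ : ∀ {xs ys : List A} → Unique xs → All (_∈ ys) xs → length xs ≤ length ys
  unique⊆⇒length≤ [] [] = z≤n
  unique⊆⇒length≤ {x ∷ xs} {ys} (x∉xs ∷ u) (x∈ys ∷ xs⊆ys) =
    subst (suc (length xs) ≤_) (sym (length-removeAt′ ys (index x∈ys)))
      (s≤s (unique⊆⇒length≤ u (All.zipWith (λ (x≢y , y∈ys) → ∈-removeAt x∈ys y∈ys (≢-sym x≢y))
                                            (x∉xs , xs⊆ys))))

module _ {A : Set} (L : List A) (P : A → Set) where

  record Only (x : A) : Set where
    field
      member : x ∈ L
      holds  : P x
      alone  : ∀ {y} → y ∈ L → P y → y ≡ x

    occupant : x ∈ L × P x
    occupant = member , holds

  record Two (x y : A) : Set where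
    field
      member₁  : x ∈ L
      holds₁   : P x
      member₂  : y ∈ L
      holds₂   : P y
      distinct : x ≢ y

    occupant₁ : x ∈ L × P x
    occupant₁ = member₁ , holds₁

    occupant₂ : y ∈ L × P y
    occupant₂ = member₂ , holds₂

  -- `two` witnesses two distinct elements satisfying P; there may be more.
  data Census : Set where
    none : (∀ {x} → x ∈ L → ¬ P x) → Census
    only : ∀ {x} → Only x → Census
    two  : ∀ {x y} → Two x y → Census

open Only public
open Two public

census : ∀ {A : Set} {P : A → Set} → Decidable P → ∀ {L} → Unique L → Census L P
census P? {[]} [] = none λ ()
census P? {x ∷ L} (x∉L ∷ uL) with census P? uL
... | two t = two record
  { member₁ = there (member₁ t) ; holds₁ = holds₁ t ; member₂ = there (member₂ t) ; holds₂ = holds₂ t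
  ; distinct = distinct t }
... | none n with P? x
...   | yes Px = only record
  { member = here refl ; holds = Px
  ; alone = λ { (here refl) _ → refl ; (there y∈L) Py → ⊥-elim (n y∈L Py) } }
...   | no ¬Px = none λ { (here refl) → ¬Px ; (there y∈L) → n y∈L }
census P? {x ∷ L} (x∉L ∷ uL) | only o with P? x
...   | yes Px = two record
  { member₁ = here refl ; holds₁ = Px ; member₂ = there (member o) ; holds₂ = holds o
  ; distinct = All.lookup x∉L (member o) }
...   | no ¬Px = only record
  { member = there (member o) ; holds = holds o
  ; alone = λ { (here refl) Py → ⊥-elim (¬Px Py) ; (there y∈L) → alone o y∈L } }

variable
  k l m : Peg
  T : QType

data Cyclic : Peg → Peg → Peg → Set where
  c₁₂₃ : Cyclic p1 p2 p3
  c₂₃₁ : Cyclic p2 p3 p1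
  c₃₁₂ : Cyclic p3 p1 p2

cyclic-rot : Cyclic k l m → Cyclic l m k
cyclic-rot c₁₂₃ = c₂₃₁
cyclic-rot c₂₃₁ = c₃₁₂
cyclic-rot c₃₁₂ = c₁₂₃

cyclic-distinct : Cyclic k l m → k ≢ l
cyclic-distinct c₁₂₃ ()
cyclic-distinct c₂₃₁ ()
cyclic-distinct c₃₁₂ ()

cyclic-elim : {P : Peg → Set} → Cyclic k l m → P k → P l → P m → ∀ p → P p
cyclic-elim c₁₂₃ x y z = λ { p1 → x ; p2 → y ; p3 → z }
cyclic-elim c₂₃₁ x y z = λ { p1 → z ; p2 → x ; p3 → y }
cyclic-elim c₃₁₂ x y z = λ { p1 → y ; p2 → z ; p3 → x }

cyclic-third : Cyclic k l m → ∀ {p} → p ≢ k → p ≢ l → p ≡ m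
cyclic-third {k} {l} {m} c {p} = cyclic-elim {P = λ p → p ≢ k → p ≢ l → p ≡ m} c
  (λ p≢k _ → ⊥-elim (p≢k refl)) (λ _ p≢l → ⊥-elim (p≢l refl)) (λ _ _ → refl) p

single⁻¹ : Peg → QType
single⁻¹ p1 = A
single⁻¹ p2 = B
single⁻¹ p3 = C

single-single⁻¹ : ∀ k → single (single⁻¹ k) ≡ k
single-single⁻¹ p1 = refl
single-single⁻¹ p2 = refl
single-single⁻¹ p3 = refl

single⁻¹-single : ∀ T → single⁻¹ (single T) ≡ T
single⁻¹-single A = refl
single⁻¹-single B = refl
single⁻¹-single C = refl

single⁻¹-distinct : k ≢ l → single⁻¹ k ≢ single⁻¹ l
single⁻¹-distinct {k} {l} k≢l e =
  k≢l (trans (sym (single-single⁻¹ k)) (trans (cong single e) (single-single⁻¹ l)))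

≢-single : k ≢ l → k ≢ single (single⁻¹ l)
≢-single {l = l} k≢l e = k≢l (trans e (single-single⁻¹ l))

component : Peg → ℕ × ℕ × ℕ → ℕ
component p1 (x , _ , _) = x
component p2 (_ , y , _) = y
component p3 (_ , _ , z) = z

typeVec-component : ∀ T k → k ≡ single T × component k (typeVec T) ≡ 1
                          ⊎ k ≢ single T × component k (typeVec T) ≡ 2
typeVec-component A p1 = inj₁ (refl , refl)
typeVec-component A p2 = inj₂ ((λ ()) , refl)
typeVec-component A p3 = inj₂ ((λ ()) , refl)
typeVec-component B p1 = inj₂ ((λ ()) , refl)
typeVec-component B p2 = inj₁ (refl , refl)
typeVec-component B p3 = inj₂ ((λ ()) , refl)
typeVec-component C p1 = inj₂ ((λ ()) , refl)
typeVec-component C p2 = inj₂ ((λ ()) , refl)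
typeVec-component C p3 = inj₁ (refl , refl)

module _ {a b c : ℕ} where

  private variable s s' q r w : Question {a} {b} {c}

  _≈[_]_ : Question {a} {b} {c} → Peg → Question {a} {b} {c} → Set
  q ≈[ k ] s = entry k q ≡ entry k s

  _≈?[_]_ : (q : Question {a} {b} {c}) (k : Peg) (s : Question {a} {b} {c}) → Dec (q ≈[ k ] s)
  q ≈?[ k ] s = entry k q ≟c entry k s

  other-color : ¬ s ≈[ k ] s' → q ≈[ k ] s → ¬ q ≈[ k ] s'
  other-color s≉s' q≈s q≈s' = s≉s' (trans (sym q≈s) q≈s')

  agree-≈ : q ≈[ k ] s → agree k s q ≡ 1
  agree-≈ {q} {k} {s} q≈s with entry k s ≟c entry k q
  ... | yes _ = refl
  ... | no s≉q = ⊥-elim (s≉q (sym q≈s))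

  agree-≉ : ¬ q ≈[ k ] s → agree k s q ≡ 0
  agree-≉ {q} {k} {s} q≉s with entry k s ≟c entry k q
  ... | yes s≈q = ⊥-elim (q≉s (sym s≈q))
  ... | no _ = refl

  agree-resp : s ≈[ k ] s' → agree k s q ≡ agree k s' q
  agree-resp {s} {k} {s'} {q} s≈s' with q ≈?[ k ] s
  ... | yes q≈s = trans (agree-≈ q≈s) (sym (agree-≈ (trans q≈s s≈s')))
  ... | no q≉s = trans (agree-≉ q≉s) (sym (agree-≉ (q≉s ∘ λ q≈s' → trans q≈s' (sym s≈s'))))

  agree-sym : ∀ k (q r : Question {a} {b} {c}) → agree k q r ≡ agree k r q
  agree-sym k q r = by-cases (r ≈?[ k ] q)
    where
    by-cases : Dec (r ≈[ k ] q) → agree k q r ≡ agree k r q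
    by-cases (yes r≈q) = trans (agree-≈ r≈q) (sym (agree-≈ (sym r≈q)))
    by-cases (no r≉q) = trans (agree-≉ r≉q) (sym (agree-≉ (r≉q ∘ sym)))

  g-sym : ∀ (q r : Question {a} {b} {c}) → g q r ≡ g r q
  g-sym q r = cong₂ _+_ (cong₂ _+_ (agree-sym p1 q r) (agree-sym p2 q r)) (agree-sym p3 q r)

  g-self : ∀ (q : Question {a} {b} {c}) → g q q ≡ 3
  g-self q = cong₂ _+_ (cong₂ _+_ (agree-self p1) (agree-self p2)) (agree-self p3)
    where
    agree-self : ∀ k → agree k q q ≡ 1
    agree-self k = agree-≈ {q = q} {k} {q} refl

  g-cyclic : Cyclic k l m → ∀ (s q : Question {a} {b} {c}) → g s q ≡ agree k s q + agree l s q + agree m s q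
  g-cyclic c₁₂₃ s q = refl
  g-cyclic c₂₃₁ s q = solve 3 (λ x y z → x :+ y :+ z := y :+ z :+ x) refl
    (agree p1 s q) (agree p2 s q) (agree p3 s q)
    where open +-*-Solver
  g-cyclic c₃₁₂ s q = solve 3 (λ x y z → x :+ y :+ z := z :+ x :+ y) refl
    (agree p1 s q) (agree p2 s q) (agree p3 s q)
    where open +-*-Solver

  cyclic-ext : Cyclic k l m → q ≈[ k ] r → q ≈[ l ] r → q ≈[ m ] r → q ≡ r
  cyclic-ext {q = _ , _ , _} {r = _ , _ , _} c₁₂₃ refl refl refl = refl
  cyclic-ext {q = _ , _ , _} {r = _ , _ , _} c₂₃₁ refl refl refl = refl
  cyclic-ext {q = _ , _ , _} {r = _ , _ , _} c₃₁₂ refl refl refl = refl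

module Strategy {a b c : ℕ} (Q : List (Question {a} {b} {c})) where

  private variable
    s s' q r w q₀ q₁ q₂ q₃ q₄ : Question {a} {b} {c}
    T′ : QType
    x₀ x₁ x₂ y₀ y₁ y₂ : ℕ

  Indistinguishable : Question {a} {b} {c} → Question {a} {b} {c} → Set
  Indistinguishable s s' = ∀ {q} → q ∈ Q → g s q ≡ g s' q

  distinguished-or-indistinguishable : ∀ (s s' : Question {a} {b} {c})
    → (∃[ q ] (q ∈ Q × g s q ≢ g s' q)) ⊎ Indistinguishable s s'
  distinguished-or-indistinguishable s s' with any? (λ q → ¬? (g s q ≟ g s' q)) Q
  ... | yes distinguishing = inj₁ (find distinguishing)
  ... | no nothing-distinguishes =
    inj₂ λ {q} q∈Q → decidable-stable (g s q ≟ g s' q) (nothing-distinguishes ∘ lose q∈Q)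

  -- Equal answers read peg by peg; fixing the terms to 0 or 1 leaves a closed arithmetic equation.
  balance : Cyclic k l m → Indistinguishable s s' → q ∈ Q
          → agree k s q ≡ x₀ → agree l s q ≡ x₁ → agree m s q ≡ x₂
          → agree k s' q ≡ y₀ → agree l s' q ≡ y₁ → agree m s' q ≡ y₂
          → x₀ + x₁ + x₂ ≡ y₀ + y₁ + y₂
  balance {s = s} {s'} {q} cyc ind q∈Q refl refl refl refl refl refl =
    trans (sym (g-cyclic cyc s q)) (trans (ind q∈Q) (g-cyclic cyc s' q))

  neighboring-distinct : Neighboring Q q r → q ≢ r
  neighboring-distinct {q} q~q refl with trans (sym (g-self q)) q~q
  ... | ()

  data Forbidden : Set where
    pat₁  : Pat1 Q → Forbidden
    pat₂  : Pat2 Q → Forbidden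
    pat₃  : Pat3 Q → Forbidden
    pat₄  : Pat4 Q → Forbidden
    pat₅  : Pat5 Q → Forbidden
    pat₆  : Pat6 Q → Forbidden
    pat₇  : Pat7 Q → Forbidden
    pat₈  : Pat8 Q → Forbidden
    pat₉  : Pat9 Q → Forbidden
    pat₁₀ : Pat10 Q → Forbidden
    pat₁₁ : Pat11 Q → Forbidden
    pat₁₂ : Pat12 Q → Forbidden

  missing-all-pegs : Cyclic k l m → MissingOn Q k → MissingOn Q l → MissingOn Q m → Pat2 Q
  missing-all-pegs cyc mk ml mm = missing p1 , missing p2 , missing p3
    where missing = cyclic-elim {P = MissingOn Q} cyc mk ml mm

  missing-double-pegs : Cyclic k l m → MissingOn Q k → MissingOn Q l → MissingBothDouble Q (single⁻¹ m)
  missing-double-pegs {m = m} cyc mk ml =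
    cyclic-elim {P = λ p → p ≢ single (single⁻¹ m) → MissingOn Q p} cyc
      (λ _ → mk) (λ _ → ml) (λ m≢m → ⊥-elim (m≢m (sym (single-single⁻¹ m))))

  missing-single-peg : MissingOn Q k → MissingOn Q (single (single⁻¹ k))
  missing-single-peg {k} = subst (MissingOn Q) (sym (single-single⁻¹ k))

  pairs-of-all-types : Cyclic k l m
                     → DNPair Q (single⁻¹ k) → DNPair Q (single⁻¹ l) → DNPair Q (single⁻¹ m) → Pat12 Q
  pairs-of-all-types cyc pk pl pm = pair p1 , pair p2 , pair p3
    where pair = cyclic-elim {P = DNPair Q ∘ single⁻¹} cyc pk pl pm

  seq₂-swap : IsSeq Q (T ∷ T′ ∷ []) (q ∷ r ∷ []) → IsSeq Q (T′ ∷ T ∷ []) (r ∷ q ∷ [])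
  seq₂-swap {q = q} {r} (tq ∷ tr ∷ [] , q∈Q ∷ r∈Q ∷ [] , (q≢r ∷ []) ∷ [] ∷ [] , q~r ∷ [-]) =
    tr ∷ tq ∷ [] , r∈Q ∷ q∈Q ∷ [] , (≢-sym q≢r ∷ []) ∷ [] ∷ [] , trans (g-sym r q) q~r ∷ [-]

  unmatched-color : Cyclic k l m → ¬ s ≈[ k ] s' → s ≈[ l ] s' → s ≈[ m ] s' → Indistinguishable s s'
                  → Missing Q k (entry k s)
  unmatched-color cyc s≉s' s≈s'₁ s≈s'₂ ind r r∈Q r≈s =
    1+n≢n (balance cyc ind r∈Q (agree-≈ r≈s) refl refl
             (agree-≉ (other-color s≉s' r≈s)) (sym (agree-resp s≈s'₁)) (sym (agree-resp s≈s'₂)))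

  one-peg-differs : Cyclic k l m → ¬ s ≈[ k ] s' → s ≈[ l ] s' → s ≈[ m ] s' → Indistinguishable s s'
                  → Pat1 Q
  one-peg-differs {k = k} {s = s} {s'} cyc s≉s' s≈s'₁ s≈s'₂ ind =
    k , entry k s , entry k s' , s≉s' ,
    unmatched-color cyc s≉s' s≈s'₁ s≈s'₂ ind ,
    unmatched-color cyc (s≉s' ∘ sym) (sym s≈s'₁) (sym s≈s'₂) (sym ∘ ind)

  -- Multiplicities in a typed strategy

  module _ (Q-unique : Unique Q) (Q-typed : AllTyped Q) where

    type-of : q ∈ Q → ∃[ T ] HasType Q T q
    type-of q∈Q with Q-typed _ q∈Q
    ... | inj₁ h = A , h
    ... | inj₂ (inj₁ h) = B , h
    ... | inj₂ (inj₂ h) = C , h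

    mult-type : HasType Q T q → ∀ k → mult Q k q ≡ component k (typeVec T)
    mult-type h p1 = cong (component p1) h
    mult-type h p2 = cong (component p2) h
    mult-type h p3 = cong (component p3) h

    mult≤2 : q ∈ Q → mult Q k q ≤ 2
    mult≤2 {k = k} q∈Q with type-of q∈Q
    ... | T , h with typeVec-component T k
    ...   | inj₁ (_ , is-1) = subst (_≤ 2) (sym (trans (mult-type h k) is-1)) (s≤s z≤n)
    ...   | inj₂ (_ , is-2) = subst (_≤ 2) (sym (trans (mult-type h k) is-2)) ≤-refl

    single-peg : HasType Q T q → mult Q k q ≡ 1 → k ≡ single T
    single-peg {T} {k = k} h once with typeVec-component T k
    ... | inj₁ (k≡single , _) = k≡single
    ... | inj₂ (_ , twice) with trans (sym once) (trans (mult-type h k) twice)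
    ...   | ()

    double-peg : HasType Q T q → mult Q k q ≡ 2 → k ≢ single T
    double-peg {T} {k = k} h twice with typeVec-component T k
    ... | inj₂ (k≢single , _) = k≢single
    ... | inj₁ (_ , once) with trans (sym twice) (trans (mult-type h k) once)
    ...   | ()

    retype : HasType Q T q → single T ≡ k → HasType Q (single⁻¹ k) q
    retype {T} {q} h refl = subst (λ T → HasType Q T q) (sym (single⁻¹-single T)) h

    single-type : q ∈ Q → mult Q k q ≡ 1 → HasType Q (single⁻¹ k) q
    single-type q∈Q once with type-of q∈Q
    ... | _ , h = retype h (sym (single-peg h once))

    double-type : Cyclic k l m → q ∈ Q → mult Q k q ≡ 2 → mult Q l q ≡ 2 → HasType Q (single⁻¹ m) q
    double-type cyc q∈Q twiceₖ twiceₗ with type-of q∈Q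
    ... | _ , h = retype h (cyclic-third cyc (≢-sym (double-peg h twiceₖ)) (≢-sym (double-peg h twiceₗ)))

    single-pegs-equal : q ∈ Q → mult Q k q ≡ 1 → mult Q l q ≡ 1 → k ≡ l
    single-pegs-equal q∈Q onceₖ onceₗ with type-of q∈Q
    ... | _ , h = trans (single-peg h onceₖ) (sym (single-peg h onceₗ))

    hitters : Peg → Question {a} {b} {c} → List (Question {a} {b} {c})
    hitters k s = filter (_≈?[ k ] s) Q

    mult-hitters : q ≈[ k ] s → mult Q k q ≡ length (hitters k s)
    mult-hitters {k = k} = cong (λ x → length (filter (λ q → entry k q ≟c x) Q))

    ∈-hitters : q ∈ Q → q ≈[ k ] s → q ∈ hitters k s
    ∈-hitters {k = k} {s} = ∈-filter⁺ (_≈?[ k ] s)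

    only-hitter-mult : q ∈ Q → q ≈[ k ] s → (∀ {r} → r ∈ Q → r ≈[ k ] s → r ≡ q) → mult Q k q ≡ 1
    only-hitter-mult {q} {k} {s} q∈Q q≈s alone-q =
      trans (mult-hitters q≈s) (≤-antisym at-most-q at-least-q)
      where
      at-most-q : length (hitters k s) ≤ 1
      at-most-q = unique⊆⇒length≤ {ys = q ∷ []} (filter⁺ (_≈?[ k ] s) Q-unique) (All.tabulate λ r∈hitters →
        let r∈Q , r≈s = ∈-filter⁻ (_≈?[ k ] s) r∈hitters in here (alone-q r∈Q r≈s))
      at-least-q : 1 ≤ length (hitters k s)
      at-least-q = unique⊆⇒length≤ ([] ∷ []) (∈-hitters q∈Q q≈s ∷ [])

    two-hitters-mult : q ∈ Q → q ≈[ k ] s → r ∈ Q → r ≈[ k ] s → q ≢ r → mult Q k q ≡ 2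
    two-hitters-mult q∈Q q≈s r∈Q r≈s q≢r =
      ≤-antisym (mult≤2 q∈Q) (subst (2 ≤_) (sym (mult-hitters q≈s))
        (unique⊆⇒length≤ ((q≢r ∷ []) ∷ [] ∷ [])
                         (∈-hitters q∈Q q≈s ∷ ∈-hitters r∈Q r≈s ∷ [])))

    no-three-hitters : q ∈ Q → q ≈[ k ] s → r ∈ Q → r ≈[ k ] s → w ∈ Q → w ≈[ k ] s
                     → q ≢ r → q ≢ w → r ≢ w → ⊥
    no-three-hitters q∈Q q≈s r∈Q r≈s w∈Q w≈s q≢r q≢w r≢w =
      3≰2 (≤-trans three≤mult (mult≤2 q∈Q))
      where
      three≤mult = subst (3 ≤_) (sym (mult-hitters q≈s))
        (unique⊆⇒length≤ ((q≢r ∷ q≢w ∷ []) ∷ (r≢w ∷ []) ∷ [] ∷ [])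
                         (∈-hitters q∈Q q≈s ∷ ∈-hitters r∈Q r≈s ∷ ∈-hitters w∈Q w≈s ∷ []))
      3≰2 : ¬ 3 ≤ 2
      3≰2 (s≤s (s≤s ()))

    only-hitter-type : q ∈ Q → q ≈[ k ] s → (∀ {r} → r ∈ Q → r ≈[ k ] s → r ≡ q)
                     → HasType Q (single⁻¹ k) q
    only-hitter-type q∈Q q≈s alone-q = single-type q∈Q (only-hitter-mult q∈Q q≈s alone-q)

    shared-type : Cyclic k l m → q ∈ Q → q ≈[ k ] s → q ≈[ l ] s'
                → r ∈ Q → r ≈[ k ] s → q ≢ r → w ∈ Q → w ≈[ l ] s' → q ≢ w
                → HasType Q (single⁻¹ m) q
    shared-type cyc q∈Q q≈s q≈s' r∈Q r≈s q≢r w∈Q w≈s' q≢w = double-type cyc q∈Q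
      (two-hitters-mult q∈Q q≈s r∈Q r≈s q≢r) (two-hitters-mult q∈Q q≈s' w∈Q w≈s' q≢w)

    -- Edges and secrets differing on two pegs

    Edge : Peg → Peg → Question {a} {b} {c} → Question {a} {b} {c} → Question {a} {b} {c} → Set
    Edge k l s s' q = q ≈[ k ] s × q ≈[ l ] s'

    edge? : ∀ k l s s' → Decidable (Edge k l s s')
    edge? k l s s' q = (q ≈?[ k ] s) ×-dec (q ≈?[ l ] s')

    edge-pair-dnp : Cyclic k l m → Two Q (Edge k l s s') q r → DNP Q (single⁻¹ m) q r
    edge-pair-dnp {q = q} {r} cyc record { member₁ = q∈Q ; holds₁ = q≈s , q≈s'
                                      ; member₂ = r∈Q ; holds₂ = r≈s , r≈s' ; distinct = q≢r } =
      q∈Q , r∈Q , q≢r ,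
      shared-type cyc q∈Q q≈s q≈s' r∈Q r≈s q≢r r∈Q r≈s' q≢r ,
      shared-type cyc r∈Q r≈s r≈s' q∈Q q≈s (≢-sym q≢r) q∈Q q≈s' (≢-sym q≢r) ,
      trans (g-cyclic cyc q r)
            (cong₂ _+_ (cong₂ _+_ (agree-≈ r≈ₖq) (agree-≈ r≈ₗq)) (agree-≉ r≉ₘq))
      where
      r≈ₖq = trans r≈s (sym q≈s)
      r≈ₗq = trans r≈s' (sym q≈s')
      r≉ₘq = λ r≈ₘq → q≢r (sym (cyclic-ext cyc r≈ₖq r≈ₗq r≈ₘq))

    Closed : Peg → Peg → Question {a} {b} {c} → Question {a} {b} {c} → Set
    Closed k l s s' = ∀ {q} → q ∈ Q → (q ≈[ k ] s → q ≈[ l ] s') × (q ≈[ l ] s' → q ≈[ k ] s)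

    closed-edge-not-only : Cyclic k l m → Closed k l s s' → ¬ Only Q (Edge k l s s') q
    closed-edge-not-only cyc closed o = cyclic-distinct cyc (single-pegs-equal (member o)
      (only-hitter-mult (member o) (proj₁ (holds o)) λ r∈Q r≈s →
         alone o r∈Q (r≈s , proj₁ (closed r∈Q) r≈s))
      (only-hitter-mult (member o) (proj₂ (holds o)) λ r∈Q r≈s' →
         alone o r∈Q (proj₂ (closed r∈Q) r≈s' , r≈s')))

    closed-edge-empty : Closed k l s s' → (∀ {q} → q ∈ Q → ¬ Edge k l s s' q)
                      → Missing Q k (entry k s) × Missing Q l (entry l s')
    closed-edge-empty closed empty =
      (λ r r∈Q r≈s → empty r∈Q (r≈s , proj₁ (closed r∈Q) r≈s)) ,
      (λ r r∈Q r≈s' → empty r∈Q (proj₂ (closed r∈Q) r≈s' , r≈s'))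

    closed-by-balance : Cyclic k l m → s ≈[ m ] s' → Indistinguishable s s'
                      → ¬ s ≈[ k ] s' → ¬ s ≈[ l ] s' → Closed k l s s'
    closed-by-balance {k} {l} {m} {s} {s'} cyc s≈ₘs' ind s≉ₖs' s≉ₗs' {q} q∈Q = to-l , to-k
      where
      balance₂ : agree k s q ≡ x₀ → agree l s q ≡ x₁ → agree k s' q ≡ y₀ → agree l s' q ≡ y₁
               → x₀ + x₁ ≡ y₀ + y₁
      balance₂ ek el ek' el' =
        +-cancelʳ-≡ _ _ _ (balance cyc ind q∈Q ek el refl ek' el' (sym (agree-resp s≈ₘs')))
      to-l : q ≈[ k ] s → q ≈[ l ] s'
      to-l q≈s = decidable-stable (q ≈?[ l ] s') λ q≉s' →
        1+n≢0 (balance₂ (agree-≈ q≈s) refl (agree-≉ (other-color s≉ₖs' q≈s)) (agree-≉ q≉s'))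
      to-k : q ≈[ l ] s' → q ≈[ k ] s
      to-k q≈s' = decidable-stable (q ≈?[ k ] s) λ q≉s →
        m+1+n≢0 _ (sym (balance₂ (agree-≉ q≉s) (agree-≉ (other-color (s≉ₗs' ∘ sym) q≈s'))
                                  refl (agree-≈ q≈s')))

    two-pegs-differ : Cyclic k l m → ¬ s ≈[ k ] s' → ¬ s ≈[ l ] s' → s ≈[ m ] s'
                    → Indistinguishable s s' → Forbidden
    two-pegs-differ {k} {l} {m} {s} {s'} cyc s≉ₖs' s≉ₗs' s≈ₘs' ind =
      by-census (census (edge? k l s s') Q-unique) (census (edge? k l s' s) Q-unique)
      where
      closed : Closed k l s s'
      closed = closed-by-balance cyc s≈ₘs' ind s≉ₖs' s≉ₗs'
      closed' : Closed k l s' s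
      closed' = closed-by-balance cyc (sym s≈ₘs') (sym ∘ ind) (s≉ₖs' ∘ sym) (s≉ₗs' ∘ sym)

      by-census : Census Q (Edge k l s s') → Census Q (Edge k l s' s) → Forbidden
      by-census (only o) _ = ⊥-elim (closed-edge-not-only cyc closed o)
      by-census _ (only o) = ⊥-elim (closed-edge-not-only cyc closed' o)
      by-census (none n) (none n') =
        pat₁ (k , _ , _ , s≉ₖs' , proj₁ (closed-edge-empty closed n) , proj₁ (closed-edge-empty closed' n'))
      by-census (two t) (none n') = let missₖ , missₗ = closed-edge-empty closed' n' in
        pat₉ (single⁻¹ m , (_ , _ , edge-pair-dnp cyc t) , missing-double-pegs cyc (_ , missₖ) (_ , missₗ))
      by-census (none n) (two t') = let missₖ , missₗ = closed-edge-empty closed n in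
        pat₉ (single⁻¹ m , (_ , _ , edge-pair-dnp cyc t') , missing-double-pegs cyc (_ , missₖ) (_ , missₗ))
      by-census (two t) (two t') =
        pat₁₀ (single⁻¹ m , _ , _ , _ , _ , edge-pair-dnp cyc t , edge-pair-dnp cyc t' , different-pairs)
        where
        different-pairs : ¬ _
        different-pairs (inj₁ (refl , _)) = s≉ₖs' (trans (sym (proj₁ (holds₁ t))) (proj₁ (holds₁ t')))
        different-pairs (inj₂ (refl , _)) = s≉ₖs' (trans (sym (proj₁ (holds₁ t))) (proj₁ (holds₂ t')))

    -- Secrets differing on every peg

    -- The vertex of X is (k₀ X, color of u X) and rot moves to the next vertex (k₁ X, color of u' X),
    -- so edge i of the hexagon is OnEdge (rot^ i X). The notions below depend on X only through its pegs
    -- and codes, so rot^ 6 X may stand for X and rot^ 5 X for rot⁻¹ X without any rewriting.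
    record Hexagon : Set where
      field
        k₀ k₁ k₂ : Peg
        cyclic : Cyclic k₀ k₁ k₂
        u u' : Question {a} {b} {c}
        indist : Indistinguishable u u'
        apart : ∀ k → ¬ u ≈[ k ] u'

    open Hexagon

    rot : Hexagon → Hexagon
    rot X = record
      { k₀ = k₁ X ; k₁ = k₂ X ; k₂ = k₀ X ; cyclic = cyclic-rot (cyclic X) ; u = u' X ; u' = u X
      ; indist = sym ∘ indist X ; apart = λ k → apart X k ∘ sym }

    rot⁻¹ : Hexagon → Hexagon
    rot⁻¹ X = record
      { k₀ = k₂ X ; k₁ = k₀ X ; k₂ = k₁ X ; cyclic = cyclic-rot (cyclic-rot (cyclic X))
      ; u = u' X ; u' = u X
      ; indist = sym ∘ indist X ; apart = λ k → apart X k ∘ sym }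

    rot^ : ℕ → Hexagon → Hexagon
    rot^ zero X = X
    rot^ (suc n) X = rot (rot^ n X)

    Hits : Hexagon → Question {a} {b} {c} → Set
    Hits X q = q ≈[ k₀ X ] u X

    OnEdge : Hexagon → Question {a} {b} {c} → Set
    OnEdge X = Edge (k₀ X) (k₁ X) (u X) (u' X)

    Occupant : Hexagon → Question {a} {b} {c} → Set
    Occupant X q = q ∈ Q × OnEdge X q

    Empty : Hexagon → Set
    Empty X = ∀ {q} → q ∈ Q → ¬ OnEdge X q

    Load : Hexagon → Set
    Load X = Census Q (OnEdge X)

    load : ∀ X → Load X
    load X = census (edge? (k₀ X) (k₁ X) (u X) (u' X)) Q-unique

    pegs-distinct : ∀ X → k₀ X ≢ k₁ X
    pegs-distinct X = cyclic-distinct (cyclic X)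

    types-distinct : ∀ X → single⁻¹ (k₀ X) ≢ single⁻¹ (k₁ X)
    types-distinct X = single⁻¹-distinct (pegs-distinct X)

    opposite-distinct : ∀ X → Hits X q → Hits (rot^ 3 X) r → q ≢ r
    opposite-distinct X q≈u r≈u' refl = apart X (k₀ X) (trans (sym q≈u) r≈u')

    -- Otherwise q agrees with u on k₀ and with u' on no peg.
    hit-extends : ∀ X → q ∈ Q → Hits X q → Hits (rot⁻¹ X) q ⊎ Hits (rot X) q
    hit-extends {q} X q∈Q q≈u with q ≈?[ k₂ X ] u' X | q ≈?[ k₁ X ] u' X
    ... | yes before | _ = inj₁ before
    ... | no _ | yes after = inj₂ after
    ... | no ¬before | no ¬after = ⊥-elim (1+n≢0 (balance (cyclic X) (indist X) q∈Q
      (agree-≈ q≈u) refl refl (agree-≉ (other-color (apart X _) q≈u)) (agree-≉ ¬after) (agree-≉ ¬before)))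

    -- Otherwise q agrees with u and u' on different numbers of pegs (two and one, resp. one and two).
    edge-misses-next : ∀ X → q ∈ Q → OnEdge X q → ¬ Hits (rot^ 2 X) q
    edge-misses-next X q∈Q (q≈u , q≈u') q≈u₂ with balance (cyclic X) (indist X) q∈Q
      (agree-≈ q≈u) (agree-≉ (other-color (apart (rot X) _) q≈u')) (agree-≈ q≈u₂)
      (agree-≉ (other-color (apart X _) q≈u)) (agree-≈ q≈u') (agree-≉ (other-color (apart X _) q≈u₂))
    ... | ()

    edge-misses-previous : ∀ X → q ∈ Q → OnEdge X q → ¬ Hits (rot⁻¹ X) q
    edge-misses-previous X q∈Q (q≈u , q≈u') q≈u'₂ with balance (cyclic X) (indist X) q∈Q
      (agree-≈ q≈u) (agree-≉ (other-color (apart (rot X) _) q≈u'))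
      (agree-≉ (other-color (apart (rot X) _) q≈u'₂))
      (agree-≉ (other-color (apart X _) q≈u)) (agree-≈ q≈u') (agree-≈ q≈u'₂)
    ... | ()

    closed-after-gap : ∀ X → Empty (rot⁻¹ X) → q ∈ Q → Hits X q → OnEdge X q
    closed-after-gap X gap q∈Q q≈u with hit-extends X q∈Q q≈u
    ... | inj₁ before = ⊥-elim (gap q∈Q (before , q≈u))
    ... | inj₂ after = q≈u , after

    closed-before-gap : ∀ X → Empty (rot X) → q ∈ Q → Hits (rot X) q → OnEdge X q
    closed-before-gap X gap q∈Q q≈u' with hit-extends (rot X) q∈Q q≈u'
    ... | inj₁ before = before , q≈u'
    ... | inj₂ after = ⊥-elim (gap q∈Q (q≈u' , after))

    adjacent-neighboring : ∀ X → Occupant X q → Occupant (rot X) r → Neighboring Q q r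
    adjacent-neighboring {q} {r} X (q∈Q , q≈u , q≈u') (r∈Q , r≈u' , r≈u) =
      trans (g-cyclic (cyclic X) q r)
            (cong₂ _+_ (cong₂ _+_ (agree-≉ r≉₀q) (agree-≈ (trans r≈u' (sym q≈u')))) (agree-≉ r≉₂q))
      where
      r≉₀q : ¬ r ≈[ k₀ X ] q
      r≉₀q r≈q = edge-misses-previous (rot X) r∈Q (r≈u' , r≈u) (trans r≈q q≈u)
      r≉₂q : ¬ r ≈[ k₂ X ] q
      r≉₂q r≈q = edge-misses-next X q∈Q (q≈u , q≈u') (trans (sym r≈q) r≈u)

    adjacent-distinct : ∀ X → Occupant X q → Occupant (rot X) r → q ≢ r
    adjacent-distinct X o o' = neighboring-distinct (adjacent-neighboring X o o')

    first-type : ∀ X → Empty (rot⁻¹ X) → Only Q (OnEdge X) q → HasType Q (single⁻¹ (k₀ X)) q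
    first-type X gap o = only-hitter-type (member o) (proj₁ (holds o)) λ r∈Q r≈u →
      alone o r∈Q (closed-after-gap X gap r∈Q r≈u)

    last-type : ∀ X → Only Q (OnEdge X) q → Empty (rot X) → HasType Q (single⁻¹ (k₁ X)) q
    last-type X o gap = only-hitter-type (member o) (proj₂ (holds o)) λ r∈Q r≈u' →
      alone o r∈Q (closed-before-gap X gap r∈Q r≈u')

    inner-type : ∀ X → Occupant (rot⁻¹ X) r → Occupant X q → Occupant (rot X) w
               → HasType Q (single⁻¹ (k₂ X)) q
    inner-type X o⁻@(r∈Q , _ , r≈u) o@(q∈Q , q≈u , q≈u') o⁺@(w∈Q , w≈u' , _) =
      shared-type (cyclic X) q∈Q q≈u q≈u' r∈Q r≈u (≢-sym (adjacent-distinct (rot⁻¹ X) o⁻ o))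
                                           w∈Q w≈u' (adjacent-distinct X o o⁺)

    isolated : ∀ X → Empty (rot⁻¹ X) → Only Q (OnEdge X) q → Empty (rot X) → ⊥
    isolated X gap o gap' = closed-edge-not-only (cyclic X)
      (λ r∈Q → proj₂ ∘ closed-after-gap X gap r∈Q , proj₁ ∘ closed-before-gap X gap' r∈Q) o

    crowded-after : ∀ X → Two Q (OnEdge X) q r → Occupant (rot X) w → ⊥
    crowded-after X t o@(w∈Q , w≈u' , _) = no-three-hitters
      (member₁ t) (proj₂ (holds₁ t)) (member₂ t) (proj₂ (holds₂ t)) w∈Q w≈u'
      (distinct t) (adjacent-distinct X (occupant₁ t) o) (adjacent-distinct X (occupant₂ t) o)

    crowded-before : ∀ X → Occupant X w → Two Q (OnEdge (rot X)) q r → ⊥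
    crowded-before X o@(w∈Q , _ , w≈u') t = no-three-hitters
      w∈Q w≈u' (member₁ t) (proj₁ (holds₁ t)) (member₂ t) (proj₁ (holds₂ t))
      (adjacent-distinct X o (occupant₁ t)) (adjacent-distinct X o (occupant₂ t)) (distinct t)

    empty-after-pair : ∀ X → Two Q (OnEdge X) q r → Load (rot X) → Empty (rot X)
    empty-after-pair X t (none gap) = gap
    empty-after-pair X t (only o) = ⊥-elim (crowded-after X t (occupant o))
    empty-after-pair X t (two t') = ⊥-elim (crowded-after X t (occupant₁ t'))

    empty-before-pair : ∀ X → Load (rot⁻¹ X) → Two Q (OnEdge X) q r → Empty (rot⁻¹ X)
    empty-before-pair X (none gap) t = gap
    empty-before-pair X (only o) t = ⊥-elim (crowded-before (rot⁻¹ X) (occupant o) t)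
    empty-before-pair X (two t') t = ⊥-elim (crowded-before (rot⁻¹ X) (occupant₁ t') t)

    only-continues : ∀ X → Empty (rot⁻¹ X) → Only Q (OnEdge X) q → Load (rot X)
                   → ∃ (Only Q (OnEdge (rot X)))
    only-continues X gap o (none gap') = ⊥-elim (isolated X gap o gap')
    only-continues X gap o (only o') = _ , o'
    only-continues X gap o (two t) = ⊥-elim (crowded-before X (occupant o) t)

    -- qs occupy at most n consecutive edges, starting with the edge of X.
    data Run : ℕ → Hexagon → List (Question {a} {b} {c}) → Set where
      []  : ∀ {n X} → Run n X []
      _∷_ : ∀ {n X q qs} → Occupant X q → Run n (rot X) qs → Run (suc n) X (q ∷ qs)

    run-members : ∀ {n X qs} → Run n X qs → All (_∈ Q) qs
    run-members [] = []
    run-members (o ∷ os) = proj₁ o ∷ run-members os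

    run-linked : ∀ {n qs} X → Run n X qs → Linked (Neighboring Q) qs
    run-linked X [] = []
    run-linked X (o ∷ []) = [-]
    run-linked X (o ∷ os@(o' ∷ _)) = adjacent-neighboring X o o' ∷ run-linked (rot X) os

    -- The second to fourth edges after that of X contain a vertex opposite to one of its vertices.
    distinct-at-2 : ∀ X → Occupant X q → Occupant (rot^ 2 X) r → q ≢ r
    distinct-at-2 X (_ , q≈u , _) (_ , _ , r≈u') = opposite-distinct X q≈u r≈u'

    distinct-at-3 : ∀ X → Occupant X q → Occupant (rot^ 3 X) r → q ≢ r
    distinct-at-3 X (_ , q≈u , _) (_ , r≈u' , _) = opposite-distinct X q≈u r≈u'

    distinct-at-4 : ∀ X → Occupant X q → Occupant (rot^ 4 X) r → q ≢ r
    distinct-at-4 X (_ , _ , q≈u') (_ , r≈u , _) = opposite-distinct (rot X) q≈u' r≈u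

    run-avoids : ∀ {n qs} X → Occupant X q → Run n (rot X) qs → n ≤ 4 → All (q ≢_) qs
    run-avoids X o [] _ = []
    run-avoids X o (o₁ ∷ []) _ = adjacent-distinct X o o₁ ∷ []
    run-avoids X o (o₁ ∷ o₂ ∷ []) _ = adjacent-distinct X o o₁ ∷ distinct-at-2 X o o₂ ∷ []
    run-avoids X o (o₁ ∷ o₂ ∷ o₃ ∷ []) _ =
      adjacent-distinct X o o₁ ∷ distinct-at-2 X o o₂ ∷ distinct-at-3 X o o₃ ∷ []
    run-avoids X o (o₁ ∷ o₂ ∷ o₃ ∷ o₄ ∷ []) _ =
      adjacent-distinct X o o₁ ∷ distinct-at-2 X o o₂ ∷ distinct-at-3 X o o₃ ∷ distinct-at-4 X o o₄ ∷ []
    run-avoids X o (_ ∷ _ ∷ _ ∷ _ ∷ _ ∷ _) (s≤s (s≤s (s≤s (s≤s ()))))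

    run-unique : ∀ {n qs} X → n ≤ 5 → Run n X qs → Unique qs
    run-unique X _ [] = []
    run-unique X (s≤s n≤4) (o ∷ os) = run-avoids X o os n≤4 ∷ run-unique (rot X) (m≤n⇒m≤1+n n≤4) os

    run-seq : ∀ {qs ts} X → Run 5 X qs → Pointwise (HasType Q) ts qs → IsSeq Q ts qs
    run-seq X run types = types , run-members run , run-unique X ≤-refl run , run-linked X run

    run₃-seq : ∀ X → Empty (rot⁻¹ X)
             → Only Q (OnEdge X) q₀ → Only Q (OnEdge (rot X)) q₁ → Only Q (OnEdge (rot^ 2 X)) q₂
             → Empty (rot^ 3 X)
             → Seq Q (single⁻¹ (k₀ X) ∷ single⁻¹ (k₀ X) ∷ single⁻¹ (k₀ X) ∷ [])
    run₃-seq X gap o₀ o₁ o₂ gap' = _ , run-seq X (e₀ ∷ e₁ ∷ e₂ ∷ [])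
      (first-type X gap o₀ ∷ inner-type (rot X) e₀ e₁ e₂ ∷ last-type (rot^ 2 X) o₂ gap' ∷ [])
      where
      e₀ = occupant o₀
      e₁ = occupant o₁
      e₂ = occupant o₂

    opposite-runs : ∀ X → T ≢ T′
                  → Occupant X q₀ → Occupant (rot X) q₁ → Occupant (rot^ 3 X) q₃ → Occupant (rot^ 4 X) q₄
                  → HasType Q T q₀ → HasType Q T′ q₁ → HasType Q T q₃ → HasType Q T′ q₄ → Pat7 Q
    opposite-runs X T≢T′ o₀ o₁ o₃ o₄ t₀ t₁ t₃ t₄ =
      _ , _ , T≢T′ , _ , _ ,
      run-seq X (o₀ ∷ o₁ ∷ []) (t₀ ∷ t₁ ∷ []) , run-seq (rot^ 3 X) (o₃ ∷ o₄ ∷ []) (t₃ ∷ t₄ ∷ []) ,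
      distinct-at-3 X o₀ o₃ ∘ ∷-injectiveˡ

    missing-vertex : ∀ X → Empty (rot⁻¹ X) → Empty X → Missing Q (k₀ X) (entry (k₀ X) (u X))
    missing-vertex X gap gap' r r∈Q r≈u = gap' r∈Q (closed-after-gap X gap r∈Q r≈u)

    missing-at : ∀ X → Empty (rot⁻¹ X) → Empty X → MissingOn Q (k₀ X)
    missing-at X gap gap' = _ , missing-vertex X gap gap'

    opposite-gaps : ∀ X → Empty (rot⁻¹ X) → Empty X → Empty (rot^ 2 X) → Empty (rot^ 3 X) → Pat1 Q
    opposite-gaps X gap₅ gap₀ gap₂ gap₃ =
      k₀ X , _ , _ , apart X (k₀ X) , missing-vertex X gap₅ gap₀ , missing-vertex (rot^ 3 X) gap₂ gap₃

    dn-pair : ∀ X → Two Q (OnEdge X) q r → DNPair Q (single⁻¹ (k₂ X))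
    dn-pair X t = _ , _ , edge-pair-dnp (cyclic X) t

    pair-case : ∀ X → Two Q (OnEdge X) q r → Forbidden
    pair-case X t =
      between-gaps (empty-before-pair X (load (rot⁻¹ X)) t) (empty-after-pair X t (load (rot X)))
                   (load (rot^ 2 X)) (load (rot^ 3 X)) (load (rot^ 4 X))
      where
      between-gaps : Empty (rot^ 5 X) → Empty (rot X)
                   → Load (rot^ 2 X) → Load (rot^ 3 X) → Load (rot^ 4 X) → Forbidden
      between-gaps gap₅ gap₁ (none gap₂) (none gap₃) (none gap₄) =
        pat₁ (opposite-gaps (rot^ 2 X) gap₁ gap₂ gap₄ gap₅)
      between-gaps gap₅ gap₁ (none gap₂) (none gap₃) (only o₄) =
        ⊥-elim (isolated (rot^ 4 X) gap₃ o₄ gap₅)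
      between-gaps gap₅ gap₁ (none gap₂) (none gap₃) (two t₄) =
        pat₁₁ (_ , _ , types-distinct (rot^ 2 X) , dn-pair X t , dn-pair (rot^ 4 X) t₄ ,
               missing-single-peg (missing-at (rot^ 2 X) gap₁ gap₂) ,
               missing-single-peg (missing-at (rot^ 3 X) gap₂ gap₃))
      between-gaps gap₅ gap₁ (none gap₂) (only o₃) load₄ with only-continues (rot^ 3 X) gap₂ o₃ load₄
      ... | _ , o₄ =
        pat₈ (_ , _ , ≢-sym (types-distinct (rot^ 2 X)) ,
              (_ , run-seq (rot^ 3 X) (occupant o₃ ∷ occupant o₄ ∷ [])
                     (first-type (rot^ 3 X) gap₂ o₃ ∷ last-type (rot^ 4 X) o₄ gap₅ ∷ [])) ,
              dn-pair X t , missing-single-peg (missing-at (rot^ 2 X) gap₁ gap₂))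
      between-gaps gap₅ gap₁ (none gap₂) (two t₃) load₄ =
        pat₁ (opposite-gaps (rot^ 2 X) gap₁ gap₂ (empty-after-pair (rot^ 3 X) t₃ load₄) gap₅)
      between-gaps gap₅ gap₁ (only o₂) load₃ load₄ with only-continues (rot^ 2 X) gap₁ o₂ load₃ | load₄
      ... | _ , o₃ | none gap₄ =
        pat₈ (_ , _ , types-distinct (rot X) ,
              (_ , seq₂-swap (run-seq (rot^ 2 X) (occupant o₂ ∷ occupant o₃ ∷ [])
                                (first-type (rot^ 2 X) gap₁ o₂ ∷ last-type (rot^ 3 X) o₃ gap₄ ∷ []))) ,
              dn-pair X t , missing-single-peg (missing-at (rot^ 5 X) gap₄ gap₅))
      ... | _ , o₃ | only o₄ = pat₄ (_ , run₃-seq (rot^ 2 X) gap₁ o₂ o₃ o₄ gap₅ , dn-pair X t)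
      ... | _ , o₃ | two t₄ = ⊥-elim (crowded-before (rot^ 3 X) (occupant o₃) t₄)
      between-gaps gap₅ gap₁ (two t₂) load₃ (none gap₄) =
        pat₁₁ (_ , _ , ≢-sym (types-distinct (rot X)) , dn-pair X t , dn-pair (rot^ 2 X) t₂ ,
               missing-single-peg (missing-at (rot^ 5 X) gap₄ gap₅) ,
               missing-single-peg (missing-at (rot^ 4 X) (empty-after-pair (rot^ 2 X) t₂ load₃) gap₄))
      between-gaps gap₅ gap₁ (two t₂) load₃ (only o₄) =
        ⊥-elim (isolated (rot^ 4 X) (empty-after-pair (rot^ 2 X) t₂ load₃) o₄ gap₅)
      between-gaps gap₅ gap₁ (two t₂) load₃ (two t₄) =
        pat₁₂ (pairs-of-all-types (cyclic X) (dn-pair (rot^ 4 X) t₄) (dn-pair (rot^ 2 X) t₂) (dn-pair X t))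

    gap-case : ∀ X → Empty (rot⁻¹ X) → Only Q (OnEdge X) q → Forbidden
    gap-case X gap₅ o₀ with only-continues X gap₅ o₀ (load (rot X))
    ... | _ , o₁ = after-two (load (rot^ 2 X)) (load (rot^ 3 X)) (load (rot^ 4 X))
      where
      e₀ = occupant o₀
      e₁ = occupant o₁

      after-two : Load (rot^ 2 X) → Load (rot^ 3 X) → Load (rot^ 4 X) → Forbidden
      after-two (two t₂) _ _ = ⊥-elim (crowded-before (rot X) e₁ t₂)
      after-two (none gap₂) (none gap₃) (none gap₄) =
        pat₂ (missing-all-pegs (cyclic X) (missing-at (rot^ 3 X) gap₂ gap₃)
                                          (missing-at (rot^ 4 X) gap₃ gap₄)
                                          (missing-at (rot^ 5 X) gap₄ gap₅))
      after-two (none gap₂) (none gap₃) (only o₄) = ⊥-elim (isolated (rot^ 4 X) gap₃ o₄ gap₅)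
      after-two (none gap₂) (none gap₃) (two t₄) = pair-case (rot^ 4 X) t₄
      after-two (none gap₂) (only o₃) load₄ with only-continues (rot^ 3 X) gap₂ o₃ load₄
      ... | _ , o₄ =
        pat₇ (opposite-runs X (≢-sym (types-distinct (rot^ 2 X))) e₀ e₁ (occupant o₃) (occupant o₄)
                (first-type X gap₅ o₀) (last-type (rot X) o₁ gap₂)
                (first-type (rot^ 3 X) gap₂ o₃) (last-type (rot^ 4 X) o₄ gap₅))
      after-two (none gap₂) (two t₃) _ = pair-case (rot^ 3 X) t₃
      after-two (only o₂) (two t₃) _ = ⊥-elim (crowded-before (rot^ 2 X) (occupant o₂) t₃)
      after-two (only o₂) (none gap₃) (none gap₄) =
        pat₃ (_ , run₃-seq X gap₅ o₀ o₁ o₂ gap₃ ,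
              missing-double-pegs (cyclic (rot X)) (missing-at (rot^ 4 X) gap₃ gap₄)
                                                   (missing-at (rot^ 5 X) gap₄ gap₅))
      after-two (only o₂) (none gap₃) (only o₄) = ⊥-elim (isolated (rot^ 4 X) gap₃ o₄ gap₅)
      after-two (only o₂) (none gap₃) (two t₄) = pair-case (rot^ 4 X) t₄
      after-two (only o₂) (only o₃) (none gap₄) =
        pat₅ (_ , _ , types-distinct X ,
              (_ , run-seq X (e₀ ∷ e₁ ∷ e₂ ∷ e₃ ∷ [])
                     (first-type X gap₅ o₀ ∷ inner-type (rot X) e₀ e₁ e₂ ∷
                      inner-type (rot^ 2 X) e₁ e₂ e₃ ∷ last-type (rot^ 3 X) o₃ gap₄ ∷ [])) ,
              k₂ X , ≢-single (pegs-distinct (rot^ 2 X)) , ≢-single (≢-sym (pegs-distinct (rot X))) ,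
              missing-at (rot^ 5 X) gap₄ gap₅)
        where
        e₂ = occupant o₂
        e₃ = occupant o₃
      after-two (only o₂) (only o₃) (only o₄) =
        pat₆ (_ , _ , _ , types-distinct X , ≢-sym (types-distinct (rot^ 2 X)) , types-distinct (rot X) ,
              (_ , run-seq X (e₀ ∷ e₁ ∷ e₂ ∷ e₃ ∷ e₄ ∷ [])
                     (first-type X gap₅ o₀ ∷ inner-type (rot X) e₀ e₁ e₂ ∷ inner-type (rot^ 2 X) e₁ e₂ e₃ ∷
                      inner-type (rot^ 3 X) e₂ e₃ e₄ ∷ last-type (rot^ 4 X) o₄ gap₅ ∷ [])))
        where
        e₂ = occupant o₂
        e₃ = occupant o₃
        e₄ = occupant o₄
      after-two (only o₂) (only o₃) (two t₄) = ⊥-elim (crowded-before (rot^ 3 X) (occupant o₃) t₄)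

    -- Some edge carries two questions, or an empty edge precedes an occupied one, or all edges look alike.
    hexagon-forbidden : Hexagon → Forbidden
    hexagon-forbidden X
      with load X | load (rot X) | load (rot^ 2 X) | load (rot^ 3 X) | load (rot^ 4 X) | load (rot^ 5 X)
    ... | two t | _ | _ | _ | _ | _ = pair-case X t
    ... | _ | two t | _ | _ | _ | _ = pair-case (rot X) t
    ... | _ | _ | two t | _ | _ | _ = pair-case (rot^ 2 X) t
    ... | _ | _ | _ | two t | _ | _ = pair-case (rot^ 3 X) t
    ... | _ | _ | _ | _ | two t | _ = pair-case (rot^ 4 X) t
    ... | _ | _ | _ | _ | _ | two t = pair-case (rot^ 5 X) t
    ... | none gap | only o | _ | _ | _ | _ = gap-case (rot X) gap o
    ... | _ | none gap | only o | _ | _ | _ = gap-case (rot^ 2 X) gap o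
    ... | _ | _ | none gap | only o | _ | _ = gap-case (rot^ 3 X) gap o
    ... | _ | _ | _ | none gap | only o | _ = gap-case (rot^ 4 X) gap o
    ... | _ | _ | _ | _ | none gap | only o = gap-case (rot^ 5 X) gap o
    ... | only o | _ | _ | _ | _ | none gap = gap-case X gap o
    ... | none gap₀ | none _ | none gap₂ | none gap₃ | none _ | none gap₅ =
      pat₁ (opposite-gaps X gap₅ gap₀ gap₂ gap₃)
    ... | only o₀ | only o₁ | only o₂ | only o₃ | only o₄ | only o₅ =
      pat₇ (opposite-runs X (types-distinct (rot^ 2 X)) e₀ e₁ e₃ e₄
              (inner-type X e₅ e₀ e₁) (inner-type (rot X) e₀ e₁ e₂)
              (inner-type (rot^ 3 X) e₂ e₃ e₄) (inner-type (rot^ 4 X) e₃ e₄ e₅))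
      where
      e₀ = occupant o₀
      e₁ = occupant o₁
      e₂ = occupant o₂
      e₃ = occupant o₃
      e₄ = occupant o₄
      e₅ = occupant o₅

    indistinguishable⇒forbidden : s ≢ s' → Indistinguishable s s' → Forbidden
    indistinguishable⇒forbidden {s = x , y , z} {s' = x' , y' , z'} s≢s' ind
      with x Fin.≟ x' | y Fin.≟ y' | z Fin.≟ z'
    ... | yes refl | yes refl | yes refl = ⊥-elim (s≢s' refl)
    ... | no x≢x' | yes y≡y' | yes z≡z' = pat₁ (one-peg-differs c₁₂₃ x≢x' y≡y' z≡z' ind)
    ... | yes x≡x' | no y≢y' | yes z≡z' = pat₁ (one-peg-differs c₂₃₁ y≢y' z≡z' x≡x' ind)
    ... | yes x≡x' | yes y≡y' | no z≢z' = pat₁ (one-peg-differs c₃₁₂ z≢z' x≡x' y≡y' ind)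
    ... | no x≢x' | no y≢y' | yes z≡z' = two-pegs-differ c₁₂₃ x≢x' y≢y' z≡z' ind
    ... | yes x≡x' | no y≢y' | no z≢z' = two-pegs-differ c₂₃₁ y≢y' z≢z' x≡x' ind
    ... | no x≢x' | yes y≡y' | no z≢z' = two-pegs-differ c₃₁₂ z≢z' x≢x' y≡y' ind
    ... | no x≢x' | no y≢y' | no z≢z' = hexagon-forbidden record
      { k₀ = p1 ; k₁ = p2 ; k₂ = p3 ; cyclic = c₁₂₃ ; u = x , y , z ; u' = x' , y' , z'
      ; indist = ind ; apart = λ { p1 → x≢x' ; p2 → y≢y' ; p3 → z≢z' } }

open Strategy using (Forbidden; distinguished-or-indistinguishable; indistinguishable⇒forbidden)
open Forbidden

lemma4 : (a b c : ℕ) (Q : List (Question {a} {b} {c})) → Unique Q → AllTyped Q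
    → ¬ Pat1 Q → ¬ Pat2 Q → ¬ Pat3 Q → ¬ Pat4 Q → ¬ Pat5 Q → ¬ Pat6 Q
    → ¬ Pat7 Q → ¬ Pat8 Q → ¬ Pat9 Q → ¬ Pat10 Q → ¬ Pat11 Q → ¬ Pat12 Q
    → Feasible Q
lemma4 a b c Q Q-unique Q-typed ¬p₁ ¬p₂ ¬p₃ ¬p₄ ¬p₅ ¬p₆ ¬p₇ ¬p₈ ¬p₉ ¬p₁₀ ¬p₁₁ ¬p₁₂
       s s' s≢s' with distinguished-or-indistinguishable Q s s'
... | inj₁ distinguishing = distinguishing
... | inj₂ ind = ⊥-elim (avoided (indistinguishable⇒forbidden Q Q-unique Q-typed s≢s' ind))
  where
  avoided : Forbidden Q → ⊥
  avoided (pat₁ p) = ¬p₁ p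
  avoided (pat₂ p) = ¬p₂ p
  avoided (pat₃ p) = ¬p₃ p
  avoided (pat₄ p) = ¬p₄ p
  avoided (pat₅ p) = ¬p₅ p
  avoided (pat₆ p) = ¬p₆ p
  avoided (pat₇ p) = ¬p₇ p
  avoided (pat₈ p) = ¬p₈ p
  avoided (pat₉ p) = ¬p₉ p
  avoided (pat₁₀ p) = ¬p₁₀ p
  avoided (pat₁₁ p) = ¬p₁₁ p
  avoided (pat₁₂ p) = ¬p₁₂ p
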